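{- Let $k=k(n)$ satisfy $k=o(n)$, and suppose that $S\subseteq\{0,1,\dots,k\}$ with $k\in S$. Then $\Delta(\bm{U}_k^n,\bm{U}_S^n)=o(1)$ as $n\to\infty$.
   Context: For $S\subseteq\{0,\dots,n\}$, $\bm{U}_S^n$ is the uniform distribution over strings in $\{0,1\}^n$ whose Hamming weight lies in $S$, and $\bm{U}_k^n=\bm{U}_{\{k\}}^n$. $\Delta(P,Q)=\max_A|P(A)-Q(A)|$ is statistical distance. -}

module Defs where

open import Data.Bool using (Bool; true; false; if_then_else_)
open import Data.Nat as ℕ using (ℕ; zero; suc; _≤_)
open import Data.Integer using (+_)
open import Data.List using (List; []; _∷_; _++_; map; filter; length; foldr)
open import Data.Vec using (Vec; []; _∷_)
open import Data.Rational as ℚ using (ℚ; 0ℚ; _/_; _+_; _-_; _*_; ∣_∣)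
open import Relation.Binary.PropositionalEquality using (_≡_)
open import Relation.Nullary.Decidable using (does)
open import Data.Bool.Properties using () renaming (_≟_ to _≟ᵇ_)
open import Data.Product using (∃-syntax)

allStrings : (n : ℕ) → List (Vec Bool n)
allStrings zero = [] ∷ []
allStrings (suc n) = map (true ∷_) (allStrings n) ++ map (false ∷_) (allStrings n)

weight : ∀ {n} → Vec Bool n → ℕ
weight [] = 0
weight (true ∷ x) = suc (weight x)
weight (false ∷ x) = weight x

WeightSet : Set
WeightSet = ℕ → Bool

single : ℕ → WeightSet
single k j = does (j ℕ.≟ k)

supportSize : WeightSet → (n : ℕ) → ℕ
supportSize S n = length (filter (λ x → S (weight x) ≟ᵇ true) (allStrings n))

-- 1/m as a rational, with the convention 1/0 = 0 (only relevant when the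
-- support is empty, which never happens for large n in the theorem).
inv : ℕ → ℚ
inv zero = 0ℚ
inv (suc m) = (+ 1) / suc m

U : WeightSet → (n : ℕ) → Vec Bool n → ℚ
U S n x = if S (weight x) then inv (supportSize S n) else 0ℚ

Pr : ∀ {n} → (Vec Bool n → ℚ) → (Vec Bool n → Bool) → ℚ
Pr {n} P A = foldr _+_ 0ℚ (map (λ x → if A x then P x else 0ℚ) (allStrings n))

StatDist≤ : ∀ {n} → (Vec Bool n → ℚ) → (Vec Bool n → ℚ) → ℚ → Set
StatDist≤ {n} P Q ε = ∀ (A : Vec Bool n → Bool) → ∣ Pr P A - Pr Q A ∣ ℚ.≤ ε

LittleO-n : (ℕ → ℕ) → Set
LittleO-n f = ∀ (ε : ℚ) → ε ℚ.> 0ℚ →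
  ∃[ N ] (∀ n → N ≤ n → ((+ f n) / 1) ℚ.≤ ε * ((+ n) / 1))

-- Let c = C(n,k) be the number of strings of weight k, m the size of the support of U_S,
-- and D the number of strings of weight below k, so that c ≤ m ≤ c + D. For any event A
-- the probabilities U_k(A) and U_S(A) differ by at most D/c, because U_S spreads its mass
-- over the same c strings plus at most D others. By the absorption identity
-- (j+1)·C(n,j+1) = (n−j)·C(n,j), the binomial coefficients below k grow by a factor q+1 at
-- every step once (q+2)·k ≤ n, which gives D·q ≤ C(n,k); as k = o(n) this eventually holds
-- for every q.

{-# OPTIONS --safe #-}
module Submission where

open import Defs
open import Data.Nat using (ℕ; _≤_)
open import Data.Bool using (Bool; true)
open import Data.Rational using (ℚ; 0ℚ; _>_)
open import Data.Product using (∃-syntax)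
open import Relation.Binary.PropositionalEquality using (_≡_)

open import Data.Bool using (false; _∧_; if_then_else_; T)
open import Data.Bool.Properties using () renaming (_≟_ to _≟ᵇ_)
open import Data.Integer as ℤ using (+_; +[1+_]; -[1+_]; _⊖_)
import Data.Integer.Properties as ℤ
open import Data.List using (List; []; _∷_; _++_; map; filter; length; foldr)
open import Data.Nat using (zero; suc; _<_; _+_; _*_; _≡ᵇ_; _<ᵇ_; z≤n; s≤s; z<s)
open import Data.Nat.Properties
open import Data.Nat.Tactic.RingSolver using (solve-∀)
open import Data.Product using (_,_; proj₁; proj₂)
open import Data.Rational as ℚ using (1ℚ; mkℚ; toℚᵘ; _/_)
import Data.Rational.Properties as ℚ
open import Data.Rational.Unnormalised as ℚᵘ using (mkℚᵘ; *≡*; *≤*)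
import Data.Rational.Unnormalised.Properties as ℚᵘ
open import Data.Sum using (_⊎_; inj₁; inj₂)
open import Data.Unit using (tt)
open import Data.Vec using (Vec; _∷_)
open import Function using (_∘_)
open import Relation.Binary.PropositionalEquality
  using (refl; sym; trans; cong; cong₂; subst; subst₂; module ≡-Reasoning)

toℕ : Bool → ℕ
toℕ false = 0
toℕ true  = 1

∑ : {X : Set} → List X → (X → ℕ) → ℕ
∑ []       f = 0
∑ (x ∷ xs) f = f x + ∑ xs f

module _ {X : Set} where

  ∑-++ : ∀ (xs ys : List X) f → ∑ (xs ++ ys) f ≡ ∑ xs f + ∑ ys f
  ∑-++ []       ys f = refl
  ∑-++ (x ∷ xs) ys f = trans (cong (_+_ (f x)) (∑-++ xs ys f)) (sym (+-assoc (f x) _ _))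

  ∑-map : ∀ {Y : Set} (g : Y → X) ys f → ∑ (map g ys) f ≡ ∑ ys (f ∘ g)
  ∑-map g []       f = refl
  ∑-map g (y ∷ ys) f = cong (_+_ (f (g y))) (∑-map g ys f)

  ∑-cong : ∀ (xs : List X) {f g} → (∀ x → f x ≡ g x) → ∑ xs f ≡ ∑ xs g
  ∑-cong []       f≡g = refl
  ∑-cong (x ∷ xs) f≡g = cong₂ _+_ (f≡g x) (∑-cong xs f≡g)

  ∑-mono : ∀ (xs : List X) {f g} → (∀ x → f x ≤ g x) → ∑ xs f ≤ ∑ xs g
  ∑-mono []       f≤g = z≤n
  ∑-mono (x ∷ xs) f≤g = +-mono-≤ (f≤g x) (∑-mono xs f≤g)

  ∑-zero : ∀ (xs : List X) → ∑ xs (λ _ → 0) ≡ 0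
  ∑-zero []       = refl
  ∑-zero (x ∷ xs) = ∑-zero xs

  ∑-+ : ∀ (xs : List X) f g → ∑ xs (λ x → f x + g x) ≡ ∑ xs f + ∑ xs g
  ∑-+ []       f g = refl
  ∑-+ (x ∷ xs) f g =
    trans (cong (_+_ (f x + g x)) (∑-+ xs f g)) (interchange (f x) (g x) _ _)
    where
    interchange : ∀ a b c d → (a + b) + (c + d) ≡ (a + c) + (b + d)
    interchange = solve-∀

  length-filter : ∀ (p : X → Bool) xs →
    length (filter (λ x → p x ≟ᵇ true) xs) ≡ ∑ xs (toℕ ∘ p)
  length-filter p []       = refl
  length-filter p (x ∷ xs) with p x
  ... | true  = cong suc (length-filter p xs)
  ... | false = length-filter p xs

∑-allStrings : ∀ n f → ∑ (allStrings (suc n)) f ≡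
  ∑ (allStrings n) (f ∘ (true ∷_)) + ∑ (allStrings n) (f ∘ (false ∷_))
∑-allStrings n f = trans (∑-++ (map (true ∷_) (allStrings n)) _ f)
  (cong₂ _+_ (∑-map (true ∷_) (allStrings n) f) (∑-map (false ∷_) (allStrings n) f))

#weight : ℕ → ℕ → ℕ
#weight n j = ∑ (allStrings n) (λ x → toℕ (weight x ≡ᵇ j))

#below : ℕ → ℕ → ℕ
#below n j = ∑ (allStrings n) (λ x → toℕ (weight x <ᵇ j))

#weight-suc-suc : ∀ n j → #weight (suc n) (suc j) ≡ #weight n j + #weight n (suc j)
#weight-suc-suc n j = ∑-allStrings n _

#weight-suc-zero : ∀ n → #weight (suc n) 0 ≡ #weight n 0
#weight-suc-zero n = trans (∑-allStrings n _) (cong (_+ #weight n 0) (∑-zero (allStrings n)))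

#weight-pos : ∀ {n j} → j ≤ n → 0 < #weight n j
#weight-pos {zero}  z≤n = z<s
#weight-pos {suc n} {zero} _ rewrite #weight-suc-zero n = #weight-pos {n} z≤n
#weight-pos {suc n} {suc j} (s≤s j≤n) rewrite #weight-suc-suc n j =
  <-≤-trans (#weight-pos j≤n) (m≤m+n _ _)

-- The absorption identity, with j·C(n,j) moved to the left so that no subtraction occurs.
#weight-absorption : ∀ n j → suc j * #weight n (suc j) + j * #weight n j ≡ n * #weight n j
#weight-absorption zero    zero    = refl
#weight-absorption zero    (suc j) = cong₂ _+_ (*-zeroʳ (suc (suc j))) (*-zeroʳ (suc j))
#weight-absorption (suc n) zero    = begin
    1 * #weight (suc n) 1 + 0 * #weight (suc n) 0
  ≡⟨ cong₂ (λ u v → 1 * u + 0 * v) (#weight-suc-suc n 0) (#weight-suc-zero n) ⟩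
    1 * (W₀ + W₁) + 0 * W₀
  ≡⟨ regroup W₀ W₁ ⟩
    W₀ + (1 * W₁ + 0 * W₀)
  ≡⟨ cong (_+_ W₀) (#weight-absorption n 0) ⟩
    suc n * W₀
  ≡⟨ cong (suc n *_) (#weight-suc-zero n) ⟨
    suc n * #weight (suc n) 0
  ∎
  where
  open ≡-Reasoning
  W₀ = #weight n 0
  W₁ = #weight n 1
  regroup : ∀ a b → 1 * (a + b) + 0 * a ≡ a + (1 * b + 0 * a)
  regroup = solve-∀
#weight-absorption (suc n) (suc j) = begin
    suc (suc j) * #weight (suc n) (suc (suc j)) + suc j * #weight (suc n) (suc j)
  ≡⟨ cong₂ (λ u v → suc (suc j) * u + suc j * v)
           (#weight-suc-suc n (suc j)) (#weight-suc-suc n j) ⟩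
    suc (suc j) * (W₁ + W₂) + suc j * (W₀ + W₁)
  ≡⟨ regroup j W₀ W₁ W₂ ⟩
    (W₀ + W₁) + ((suc (suc j) * W₂ + suc j * W₁) + (suc j * W₁ + j * W₀))
  ≡⟨ cong₂ (λ u v → (W₀ + W₁) + (u + v))
           (#weight-absorption n (suc j)) (#weight-absorption n j) ⟩
    (W₀ + W₁) + (n * W₁ + n * W₀)
  ≡⟨ cong (_+_ (W₀ + W₁)) (trans (+-comm (n * W₁) _) (sym (*-distribˡ-+ n W₀ W₁))) ⟩
    suc n * (W₀ + W₁)
  ≡⟨ cong (suc n *_) (#weight-suc-suc n j) ⟨
    suc n * #weight (suc n) (suc j)
  ∎
  where
  open ≡-Reasoning
  W₀ = #weight n j
  W₁ = #weight n (suc j)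
  W₂ = #weight n (suc (suc j))
  regroup : ∀ j a b c → suc (suc j) * (b + c) + suc j * (a + b) ≡
    (a + b) + ((suc (suc j) * c + suc j * b) + (suc j * b + j * a))
  regroup = solve-∀

#weight-growth : ∀ {n q j} → suc q * suc j + j ≤ n → #weight n j * suc q ≤ #weight n (suc j)
#weight-growth {n} {q} {j} j-small = *-cancelˡ-≤ (suc j) (+-cancelʳ-≤ (j * W) _ _ (begin
    suc j * (W * suc q) + j * W  ≡⟨ expand j q W ⟩
    W * (suc q * suc j + j)      ≤⟨ *-monoʳ-≤ W j-small ⟩
    W * n                        ≡⟨ *-comm W n ⟩
    n * W                        ≡⟨ #weight-absorption n j ⟨
    suc j * #weight n (suc j) + j * W ∎))
  where
  open ≤-Reasoning
  W = #weight n j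
  expand : ∀ j q w → suc j * (w * suc q) + j * w ≡ w * (suc q * suc j + j)
  expand = solve-∀

toℕ-<ᵇ-suc : ∀ w k → toℕ (w <ᵇ suc k) ≡ toℕ (w <ᵇ k) + toℕ (w ≡ᵇ k)
toℕ-<ᵇ-suc zero    zero    = refl
toℕ-<ᵇ-suc zero    (suc k) = refl
toℕ-<ᵇ-suc (suc w) zero    = refl
toℕ-<ᵇ-suc (suc w) (suc k) = toℕ-<ᵇ-suc w k

#below-suc : ∀ n j → #below n (suc j) ≡ #below n j + #weight n j
#below-suc n j =
  trans (∑-cong (allStrings n) (λ x → toℕ-<ᵇ-suc (weight x) j)) (∑-+ (allStrings n) _ _)

#below*≤#weight : ∀ {n k q} → (2 + q) * k ≤ n → ∀ {j} → j ≤ k → #below n j * q ≤ #weight n j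
#below*≤#weight {n} {q = q} _ {zero} _ =
  subst (λ b → b * q ≤ #weight n 0) (sym (∑-zero (allStrings n))) z≤n
#below*≤#weight {n} {k} {q} k-small {suc j} j<k = begin
    #below n (suc j) * q      ≡⟨ cong (_* q) (#below-suc n j) ⟩
    (#below n j + W) * q      ≡⟨ *-distribʳ-+ q (#below n j) W ⟩
    #below n j * q + W * q    ≤⟨ +-monoˡ-≤ (W * q) (#below*≤#weight k-small (<⇒≤ j<k)) ⟩
    W + W * q                 ≡⟨ *-suc W q ⟨
    W * suc q                 ≤⟨ #weight-growth (≤-trans growth-range k-small) ⟩
    #weight n (suc j)         ∎
  where
  open ≤-Reasoning
  W = #weight n j
  growth-range : suc q * suc j + j ≤ (2 + q) * k
  growth-range = ≤-trans (≤-reflexive (+-comm _ j))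
    (+-mono-≤ (<⇒≤ j<k) (*-monoʳ-≤ (suc q) j<k))

toℕ-∧-≤ʳ : ∀ a b → toℕ (a ∧ b) ≤ toℕ b
toℕ-∧-≤ʳ true  b = ≤-refl
toℕ-∧-≤ʳ false b = z≤n

toℕ-∧-monoʳ : ∀ a {b c} → (b ≡ true → c ≡ true) → toℕ (a ∧ b) ≤ toℕ (a ∧ c)
toℕ-∧-monoʳ false        _   = z≤n
toℕ-∧-monoʳ true {false} _   = z≤n
toℕ-∧-monoʳ true {true}  b⇒c rewrite b⇒c refl = ≤-refl

toℕ-∧-cover : ∀ a {b c d} → (b ≡ true → c ≡ true ⊎ d ≡ true) →
  toℕ (a ∧ b) ≤ toℕ (a ∧ c) + toℕ d
toℕ-∧-cover false        _ = z≤n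
toℕ-∧-cover true {false} _ = z≤n
toℕ-∧-cover true {true}  b⇒c∨d with b⇒c∨d refl
... | inj₁ c≡true rewrite c≡true = s≤s z≤n
... | inj₂ d≡true rewrite d≡true = m≤n+m 1 _

≤⇒≡ᵇ⊎<ᵇ : ∀ {w k} → w ≤ k → (w ≡ᵇ k) ≡ true ⊎ (w <ᵇ k) ≡ true
≤⇒≡ᵇ⊎<ᵇ {zero} {zero}  _         = inj₁ refl
≤⇒≡ᵇ⊎<ᵇ {zero} {suc k} _         = inj₂ refl
≤⇒≡ᵇ⊎<ᵇ        (s≤s w≤k) = ≤⇒≡ᵇ⊎<ᵇ w≤k

∣⊖∣*≤ : ∀ x y Q Z → x * Q ≤ y * Q + Z → y * Q ≤ x * Q + Z → ℤ.∣ x ⊖ y ∣ * Q ≤ Z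
∣⊖∣*≤ x y Q Z xQ≤ yQ≤ with ≤-total x y
... | inj₁ x≤y rewrite ℤ.∣⊖∣-≤ x≤y =
  ≤-trans (≤-reflexive (*-distribʳ-∸ Q y x)) (m≤n+o⇒m∸n≤o (y * Q) (x * Q) yQ≤)
... | inj₂ y≤x rewrite ℤ.∣m⊖n∣≡∣n⊖m∣ x y | ℤ.∣⊖∣-≤ y≤x =
  ≤-trans (≤-reflexive (*-distribʳ-∸ Q x y)) (m≤n+o⇒m∸n≤o (x * Q) (y * Q) xQ≤)

-- |a/c − e/m| ≤ 1/Q cleared of denominators. In use, c ≤ m are the support sizes of U_k
-- and U_S, a and e the numbers of strings of A in these supports, and D bounds m − c.
cross-difference-bound : ∀ {a c e m D Q} → a ≤ c → c ≤ m → m ≤ c + D →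
  a ≤ e → e ≤ a + D → D * Q ≤ c → ℤ.∣ a * m ⊖ e * c ∣ * Q ≤ c * m
cross-difference-bound {a} {c} {e} {m} {D} {Q} a≤c c≤m m≤c+D a≤e e≤a+D DQ≤c =
  ∣⊖∣*≤ (a * m) (e * c) Q (c * m) upper lower
  where
  open ≤-Reasoning
  expand₁ : ∀ a c D Q → a * (c + D) * Q ≡ a * c * Q + a * (D * Q)
  expand₁ = solve-∀
  expand₂ : ∀ a c D Q → (a + D) * c * Q ≡ a * c * Q + c * (D * Q)
  expand₂ = solve-∀
  upper : a * m * Q ≤ e * c * Q + c * m
  upper = begin
    a * m * Q              ≤⟨ *-monoˡ-≤ Q (*-monoʳ-≤ a m≤c+D) ⟩
    a * (c + D) * Q        ≡⟨ expand₁ a c D Q ⟩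
    a * c * Q + a * (D * Q) ≤⟨ +-mono-≤ (*-monoˡ-≤ Q (*-monoˡ-≤ c a≤e))
                                       (*-mono-≤ (≤-trans a≤c c≤m) DQ≤c) ⟩
    e * c * Q + m * c      ≡⟨ cong (_+_ (e * c * Q)) (*-comm m c) ⟩
    e * c * Q + c * m      ∎
  lower : e * c * Q ≤ a * m * Q + c * m
  lower = begin
    e * c * Q               ≤⟨ *-monoˡ-≤ Q (*-monoˡ-≤ c e≤a+D) ⟩
    (a + D) * c * Q         ≡⟨ expand₂ a c D Q ⟩
    a * c * Q + c * (D * Q) ≤⟨ +-mono-≤ (*-monoˡ-≤ Q (*-monoʳ-≤ a c≤m))
                                        (*-monoʳ-≤ c (≤-trans DQ≤c c≤m)) ⟩
    a * m * Q + c * m       ∎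

#[_∩_] : ∀ {n} → (Vec Bool n → Bool) → WeightSet → ℕ
#[_∩_] {n} A S = ∑ (allStrings n) (λ x → toℕ (A x ∧ S (weight x)))

-- #support (single k) n computes to #weight n k, since single k w reduces to w ≡ᵇ k.
#support : WeightSet → ℕ → ℕ
#support S n = ∑ (allStrings n) (λ x → toℕ (S (weight x)))

module _ {n k : ℕ} {S : WeightSet}
         (S⊆[0,k] : ∀ j → S j ≡ true → j ≤ k) (k∈S : S k ≡ true) where

  private
    strings = allStrings n

    k⇒S : ∀ w → (w ≡ᵇ k) ≡ true → S w ≡ true
    k⇒S w w≡ᵇk = subst (λ v → S v ≡ true) (sym (≡ᵇ⇒≡ w k (subst T (sym w≡ᵇk) tt))) k∈S

    S⇒k⊎<k : ∀ w → S w ≡ true → (w ≡ᵇ k) ≡ true ⊎ (w <ᵇ k) ≡ true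
    S⇒k⊎<k w w∈S = ≤⇒≡ᵇ⊎<ᵇ (S⊆[0,k] w w∈S)

  #weight≤#support : #weight n k ≤ #support S n
  #weight≤#support = ∑-mono strings (λ x → toℕ-∧-monoʳ true (k⇒S (weight x)))

  event-cross-bound : ∀ (A : Vec Bool n → Bool) {Q} → #below n k * Q ≤ #weight n k →
    ℤ.∣ #[ A ∩ single k ] * #support S n ⊖ #[ A ∩ S ] * #weight n k ∣ * Q ≤
      #weight n k * #support S n
  event-cross-bound A = cross-difference-bound
    (∑-mono strings (λ x → toℕ-∧-≤ʳ (A x) _))
    #weight≤#support
    (≤-trans (∑-mono strings (λ x → toℕ-∧-cover true (S⇒k⊎<k (weight x))))
             (≤-reflexive (∑-+ strings _ _)))
    (∑-mono strings (λ x → toℕ-∧-monoʳ (A x) (k⇒S (weight x))))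
    (≤-trans (∑-mono strings (λ x → toℕ-∧-cover (A x) (S⇒k⊎<k (weight x))))
             (≤-reflexive (∑-+ strings _ _)))

ratio : ℕ → ℕ → ℚ
ratio a c = ((+ a) / 1) ℚ.* inv c

+suc/1≡1+ : ∀ c → (+ suc c) / 1 ≡ 1ℚ ℚ.+ (+ c) / 1
+suc/1≡1+ c = ℚ.toℚᵘ-injective (begin
    toℚᵘ ((+ suc c) / 1)           ≈⟨ ℚ.toℚᵘ-fromℚᵘ (mkℚᵘ (+ suc c) 0) ⟩
    mkℚᵘ (+ suc c) 0               ≈⟨ *≡* cross-multiplied ⟩
    mkℚᵘ (+ 1) 0 ℚᵘ.+ mkℚᵘ (+ c) 0 ≈⟨ ℚᵘ.+-cong (ℚ.toℚᵘ-fromℚᵘ (mkℚᵘ (+ 1) 0))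
                                               (ℚ.toℚᵘ-fromℚᵘ (mkℚᵘ (+ c) 0)) ⟨
    toℚᵘ 1ℚ ℚᵘ.+ toℚᵘ ((+ c) / 1)  ≈⟨ ℚ.toℚᵘ-homo-+ 1ℚ ((+ c) / 1) ⟨
    toℚᵘ (1ℚ ℚ.+ (+ c) / 1)        ∎)
  where
  open ℚᵘ.≃-Reasoning
  cross-multiplied : + suc c ℤ.* + 1 ≡ (+ 1 ℤ.* + 1 ℤ.+ + c ℤ.* + 1) ℤ.* + 1
  cross-multiplied = trans (ℤ.*-identityʳ _) (sym (trans (ℤ.*-identityʳ _)
    (cong (ℤ._+_ (+ 1)) (ℤ.*-identityʳ (+ c)))))

∑ℚ-indicator : ∀ {X : Set} (p q : X → Bool) v xs →
  foldr ℚ._+_ 0ℚ (map (λ x → if p x then (if q x then v else 0ℚ) else 0ℚ) xs) ≡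
    ((+ ∑ xs (λ x → toℕ (p x ∧ q x))) / 1) ℚ.* v
∑ℚ-indicator p q v []       = sym (ℚ.*-zeroˡ v)
∑ℚ-indicator p q v (x ∷ xs) with p x | q x
... | true  | true  = begin
    v ℚ.+ rest                 ≡⟨ cong (ℚ._+_ v) (∑ℚ-indicator p q v xs) ⟩
    v ℚ.+ (+ s / 1) ℚ.* v      ≡⟨ cong (ℚ._+ (+ s / 1) ℚ.* v) (ℚ.*-identityˡ v) ⟨
    1ℚ ℚ.* v ℚ.+ (+ s / 1) ℚ.* v ≡⟨ ℚ.*-distribʳ-+ v 1ℚ (+ s / 1) ⟨
    (1ℚ ℚ.+ + s / 1) ℚ.* v     ≡⟨ cong (ℚ._* v) (+suc/1≡1+ s) ⟨
    (+ suc s / 1) ℚ.* v        ∎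
  where
  open ≡-Reasoning
  s = ∑ xs (λ x → toℕ (p x ∧ q x))
  rest = foldr ℚ._+_ 0ℚ (map (λ x → if p x then (if q x then v else 0ℚ) else 0ℚ) xs)
... | true  | false = trans (ℚ.+-identityˡ _) (∑ℚ-indicator p q v xs)
... | false | _     = trans (ℚ.+-identityˡ _) (∑ℚ-indicator p q v xs)

Pr-U : ∀ {n} (S : WeightSet) (A : Vec Bool n → Bool) →
  Pr (U S n) A ≡ ratio #[ A ∩ S ] (#support S n)
Pr-U {n} S A = trans (∑ℚ-indicator A (S ∘ weight) _ (allStrings n))
  (cong (ratio #[ A ∩ S ]) (length-filter (S ∘ weight) (allStrings n)))

toℚᵘ-ratio : ∀ a c → toℚᵘ (ratio a (suc c)) ℚᵘ.≃ mkℚᵘ (+ a) c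
toℚᵘ-ratio a c = begin
    toℚᵘ (ratio a (suc c))                  ≈⟨ ℚ.toℚᵘ-homo-* ((+ a) / 1) (inv (suc c)) ⟩
    toℚᵘ ((+ a) / 1) ℚᵘ.* toℚᵘ (inv (suc c)) ≈⟨ ℚᵘ.*-cong (ℚ.toℚᵘ-fromℚᵘ (mkℚᵘ (+ a) 0))
                                                         (ℚ.toℚᵘ-fromℚᵘ (mkℚᵘ (+ 1) c)) ⟩
    mkℚᵘ (+ a) 0 ℚᵘ.* mkℚᵘ (+ 1) c          ≈⟨ *≡* cross-multiplied ⟩
    mkℚᵘ (+ a) c                            ∎
  where
  open ℚᵘ.≃-Reasoning
  cross-multiplied : (+ a ℤ.* + 1) ℤ.* + suc c ≡ + a ℤ.* + (1 * suc c)
  cross-multiplied = cong₂ ℤ._*_ (ℤ.*-identityʳ (+ a)) (cong +_ (sym (*-identityˡ (suc c))))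

∣ratio-ratio∣≤1/suc : ∀ a e {c m} q → 0 < c → 0 < m →
  ℤ.∣ a * m ⊖ e * c ∣ * suc q ≤ c * m → ℚ.∣ ratio a c ℚ.- ratio e m ∣ ℚ.≤ (+ 1) / suc q
∣ratio-ratio∣≤1/suc a e {suc c} {suc m} q _ _ cross = ℚ.toℚᵘ-cancel-≤ (begin
    toℚᵘ ℚ.∣ X ℚ.- Y ∣                    ≃⟨ ℚ.toℚᵘ-homo-∣-∣ (X ℚ.- Y) ⟩
    ℚᵘ.∣ toℚᵘ (X ℚ.- Y) ∣                 ≃⟨ ℚᵘ.∣-∣-cong (ℚᵘ.≃-trans (ℚ.toℚᵘ-homo-+ X (ℚ.- Y))
        (ℚᵘ.+-cong (toℚᵘ-ratio a c)
                   (ℚᵘ.≃-trans (ℚ.toℚᵘ-homo‿- Y) (ℚᵘ.-‿cong (toℚᵘ-ratio e m))))) ⟩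
    ℚᵘ.∣ mkℚᵘ (+ a) c ℚᵘ.- mkℚᵘ (+ e) m ∣ ≤⟨ *≤* (subst₂ ℤ._≤_ lhs rhs (ℤ.+≤+ cross)) ⟩
    mkℚᵘ (+ 1) q                          ≃⟨ ℚ.toℚᵘ-fromℚᵘ (mkℚᵘ (+ 1) q) ⟨
    toℚᵘ ((+ 1) / suc q)                  ∎)
  where
  open ℚᵘ.≤-Reasoning
  X = ratio a (suc c)
  Y = ratio e (suc m)
  numerator : + a ℤ.* + suc m ℤ.+ (ℤ.- (+ e)) ℤ.* + suc c ≡ a * suc m ⊖ e * suc c
  numerator = trans
    (cong₂ ℤ._+_ (sym (ℤ.pos-* a (suc m)))
      (trans (sym (ℤ.neg-distribˡ-* (+ e) (+ suc c))) (cong ℤ.-_ (sym (ℤ.pos-* e (suc c))))))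
    (ℤ.m-n≡m⊖n (a * suc m) (e * suc c))
  lhs : + (ℤ.∣ a * suc m ⊖ e * suc c ∣ * suc q) ≡
        + ℤ.∣ + a ℤ.* + suc m ℤ.+ (ℤ.- (+ e)) ℤ.* + suc c ∣ ℤ.* + suc q
  lhs = trans (ℤ.pos-* ℤ.∣ a * suc m ⊖ e * suc c ∣ (suc q))
              (cong (λ z → + ℤ.∣ z ∣ ℤ.* + suc q) (sym numerator))
  rhs : + (suc c * suc m) ≡ + 1 ℤ.* + (suc c * suc m)
  rhs = sym (ℤ.*-identityˡ (+ (suc c * suc m)))

1/suc>0 : ∀ r → (+ 1) / suc r > 0ℚ
1/suc>0 r = ℚ.positive⁻¹ _ {{ℚ.normalize-pos 1 (suc r)}}

1/suc-denominator≤ : ∀ ε → ε > 0ℚ → (+ 1) / suc (ℚ.denominator-1 ε) ℚ.≤ ε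
1/suc-denominator≤ (mkℚ (+ 0)     _ _) (ℚ.*<* (ℤ.+<+ ()))
1/suc-denominator≤ (mkℚ -[1+ _ ]  _ _) (ℚ.*<* ())
1/suc-denominator≤ (mkℚ +[1+ p ] d _) _ = ℚ.toℚᵘ-cancel-≤ (ℚᵘ.≤-respˡ-≃
  (ℚᵘ.≃-sym (ℚ.toℚᵘ-fromℚᵘ (mkℚᵘ (+ 1) d)))
  (*≤* (ℤ.*-monoʳ-≤-nonNeg (+ suc d) (ℤ.+≤+ {1} {suc p} (s≤s z≤n)))))

≤1/suc*⇒suc*≤ : ∀ k n r → (+ k) / 1 ℚ.≤ ((+ 1) / suc r) ℚ.* ((+ n) / 1) → suc r * k ≤ n
≤1/suc*⇒suc*≤ k n r k≤n/[1+r]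
  with ℚᵘ.≤-respʳ-≃ n/[1+r]
         (ℚᵘ.≤-respˡ-≃ (ℚ.toℚᵘ-fromℚᵘ (mkℚᵘ (+ k) 0)) (ℚ.toℚᵘ-mono-≤ k≤n/[1+r]))
  where
  n/[1+r] : toℚᵘ (((+ 1) / suc r) ℚ.* ((+ n) / 1)) ℚᵘ.≃ mkℚᵘ (+ n) r
  n/[1+r] = ℚᵘ.≃-trans (ℚ.toℚᵘ-homo-* ((+ 1) / suc r) ((+ n) / 1))
    (ℚᵘ.≃-trans (ℚᵘ.*-cong (ℚ.toℚᵘ-fromℚᵘ (mkℚᵘ (+ 1) r)) (ℚ.toℚᵘ-fromℚᵘ (mkℚᵘ (+ n) 0)))
      (*≡* (cong₂ ℤ._*_ (ℤ.*-identityˡ (+ n)) (cong +_ (sym (*-identityʳ (suc r)))))))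
... | *≤* k*[1+r]≤n*1 = ≤-trans (≤-reflexive (*-comm (suc r) k))
  (ℤ.drop‿+≤+ (subst₂ ℤ._≤_ (sym (ℤ.pos-* k (suc r))) (ℤ.*-identityʳ (+ n)) k*[1+r]≤n*1))

uniform-statDist≤ : ∀ {n k} q (S : WeightSet) → (∀ j → S j ≡ true → j ≤ k) → S k ≡ true →
  (3 + q) * k ≤ n → StatDist≤ (U (single k) n) (U S n) ((+ 1) / suc q)
uniform-statDist≤ {n} {k} q S S⊆[0,k] k∈S k-small A =
  subst₂ (λ P P′ → ℚ.∣ P ℚ.- P′ ∣ ℚ.≤ (+ 1) / suc q) (sym (Pr-U (single k) A)) (sym (Pr-U S A))
    (∣ratio-ratio∣≤1/suc #[ A ∩ single k ] #[ A ∩ S ] q #k>0 (<-≤-trans #k>0 (#weight≤#support {n} S⊆[0,k] k∈S))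
      (event-cross-bound {n} S⊆[0,k] k∈S A (#below*≤#weight {q = suc q} k-small ≤-refl)))
  where
  #k>0 : 0 < #weight n k
  #k>0 = #weight-pos (≤-trans (m≤n*m k (3 + q)) k-small)

mainTheorem8 : (k : ℕ → ℕ) → (S : ℕ → WeightSet) → LittleO-n k →
    (∀ n j → S n j ≡ true → j ≤ k n) → (∀ n → S n (k n) ≡ true) →
    ∀ (ε : ℚ) → ε > 0ℚ →
    ∃[ N ] (∀ n → N ≤ n → StatDist≤ (U (single (k n)) n) (U (S n) n) ε)
mainTheorem8 k S k=o[n] S⊆[0,k] k∈S ε ε>0 = N , Δ≤ε
  where
  d = ℚ.denominator-1 ε
  eventually-small = k=o[n] ((+ 1) / (3 + d)) (1/suc>0 (2 + d))
  N = proj₁ eventually-small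
  Δ≤ε : ∀ n → N ≤ n → StatDist≤ (U (single (k n)) n) (U (S n) n) ε
  Δ≤ε n N≤n A = ℚ.≤-trans
    (uniform-statDist≤ d (S n) (S⊆[0,k] n) (k∈S n)
      (≤1/suc*⇒suc*≤ (k n) n (2 + d) (proj₂ eventually-small n N≤n)) A)
    (1/suc-denominator≤ ε ε>0)
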